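{- There exist a (symmetric) GTSP instance and a tour $T$ of it such that $T$ has minimum weight among all tours in $N_{\mathrm{CO}}(T)\cup N_{\mathrm{TSP}}(T)$, $T$ is a longest tour of the instance, and $T$ is not a shortest tour of the instance.
   Context: A GTSP instance consists of a complete graph on a vertex set $V$ with edge weights $w(x\to y)$ and a partition of $V$ into clusters $C_1,\dots,C_m$; it is symmetric if $w(x\to y)=w(y\to x)$. A tour is a cycle visiting exactly one vertex of each cluster; its weight is the sum of its edge weights. For a tour $T$, $N_{\mathrm{CO}}(T)$ is the set of all tours that visit the clusters in the same cyclic order as $T$ (with arbitrary choice of vertex in each cluster), and $N_{\mathrm{TSP}}(T)$ is the set of all tours that visit exactly the same vertices as $T$ (in an arbitrary order). -}

module Defs where

open import Data.Nat using (ℕ; zero; suc; _+_; _≤_)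
open import Data.Fin using (Fin)
open import Data.List using (List; []; _∷_; _++_; map; reverse; allFin)
open import Data.List.Relation.Binary.Permutation.Propositional using (_↭_)
open import Data.Product using (Σ; ∃; ∃-syntax; _×_; _,_)
open import Data.Sum using (_⊎_)
open import Relation.Binary.PropositionalEquality using (_≡_)
open import Relation.Nullary using (¬_)

-- A GTSP instance: vertex set V = Fin n, clusters indexed by Fin m,
-- complete graph with weights w x y (weight of edge x → y), and the
-- partition of V into clusters given by the cluster map 'cluster',
-- which is surjective (every cluster C_j is nonempty).
record GTSP : Set where
  field
    n       : ℕ
    m       : ℕ
    w       : Fin n → Fin n → ℕ
    cluster : Fin n → Fin m
    cluster-surj : ∀ (j : Fin m) → ∃[ v ] cluster v ≡ j

open GTSP public

Symmetric : GTSP → Set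
Symmetric G = ∀ x y → w G x y ≡ w G y x

-- A tour is represented by the cyclic sequence of its vertices (as a list,
-- the closing edge goes from the last vertex back to the first).
-- It visits exactly one vertex of each cluster: the list of visited
-- clusters is a permutation of the list of all clusters.
IsTour : (G : GTSP) → List (Fin (n G)) → Set
IsTour G T = map (cluster G) T ↭ allFin (m G)

pathTo : (G : GTSP) → Fin (n G) → List (Fin (n G)) → Fin (n G) → ℕ
pathTo G x [] last = w G x last
pathTo G x (y ∷ ys) last = w G x y + pathTo G y ys last

weight : (G : GTSP) → List (Fin (n G)) → ℕ
weight G [] = 0
weight G (x ∷ xs) = pathTo G x xs x

-- two cyclic sequences are the same cyclic order: one is a rotation of the
-- other, or of its reversal (cycles are undirected)
SameCyclicOrder : {A : Set} → List A → List A → Set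
SameCyclicOrder {A} s t =
  ∃[ as ] ∃[ bs ] (s ≡ as ++ bs × (t ≡ bs ++ as ⊎ t ≡ reverse (bs ++ as)))

InNCO : (G : GTSP) → List (Fin (n G)) → List (Fin (n G)) → Set
InNCO G T T' = IsTour G T' × SameCyclicOrder (map (cluster G) T) (map (cluster G) T')

InNTSP : (G : GTSP) → List (Fin (n G)) → List (Fin (n G)) → Set
InNTSP G T T' = IsTour G T' × (T' ↭ T)

module Submission where

-- The instance has vertices 0..4 and clusters 0..3; vertex i lies in
-- cluster i for i ≤ 3 and vertex 4 is a second vertex of cluster 3.  Every
-- edge costs 1 except the edge {1,4}, which costs 0.  The tour T = 0 1 2 3
-- has 4 edges of cost 1, so it is a longest tour, while 0 2 1 4 uses the
-- cheap edge and costs 3.  T is N_TSP-optimal because the cheap edge needs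
-- vertex 4, which T does not visit; it is N_CO-optimal because in the cyclic
-- cluster order 0 1 2 3 the clusters 1 and 3 of the cheap edge are never
-- adjacent.

open import Defs
open import Data.Bool using (Bool; true; false; if_then_else_)
open import Data.Nat using (ℕ; _+_; _*_; _≤_; _≤?_; z≤n)
open import Data.Nat.Properties using (+-mono-≤; ≤-trans)
import Data.Nat.Properties as ℕ
open import Data.Fin using (Fin; zero; suc; toℕ; #_)
import Data.Fin.Properties as Fin
open import Data.List using (List; []; _∷_; _++_; map; reverse; allFin; length)
open import Data.List.Properties using (length-map; length-tabulate)
open import Data.List.Relation.Binary.Permutation.Propositional using (prep; swap; ↭-refl)
open import Data.List.Relation.Binary.Permutation.Propositional.Properties using (↭-length; ∈-resp-↭)
open import Data.List.Membership.Propositional using (_∈_)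
open import Data.List.Membership.DecPropositional (Fin._≟_ {5}) using (_∈?_)
import Data.List.Relation.Unary.All as All
open All using (All; []; _∷_)
open import Data.Product using (∃-syntax; _×_; _,_; proj₁; proj₂)
open import Data.Sum using (_⊎_; inj₁; inj₂)
open import Data.Unit using (⊤; tt)
open import Relation.Nullary using (¬_)
open import Relation.Nullary.Decidable using (toWitness; _→-dec_)
open import Relation.Binary.PropositionalEquality using (_≡_; refl; sym; cong; module ≡-Reasoning)

private
  variable
    A B : Set

pathWeight : (A → A → ℕ) → A → List A → A → ℕ
pathWeight c x []       l = c x l
pathWeight c x (y ∷ ys) l = c x y + pathWeight c y ys l

cycleWeight : (A → A → ℕ) → List A → ℕ
cycleWeight c []       = 0
cycleWeight c (x ∷ xs) = pathWeight c x xs x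

pathWeight-mono : ∀ {P : A → Set} {c d : A → A → ℕ} →
  (∀ {x y} → P x → P y → c x y ≤ d x y) →
  ∀ {x l} ys → P x → All P ys → P l → pathWeight c x ys l ≤ pathWeight d x ys l
pathWeight-mono c≤d []       px []         pl = c≤d px pl
pathWeight-mono c≤d (y ∷ ys) px (py ∷ pys) pl =
  +-mono-≤ (c≤d px py) (pathWeight-mono c≤d ys py pys pl)

cycleWeight-mono : ∀ {P : A → Set} {c d : A → A → ℕ} →
  (∀ {x y} → P x → P y → c x y ≤ d x y) →
  ∀ {xs} → All P xs → cycleWeight c xs ≤ cycleWeight d xs
cycleWeight-mono c≤d []         = z≤n
cycleWeight-mono c≤d (px ∷ pxs) = pathWeight-mono c≤d _ px pxs px

pathWeight-const : ∀ k x ys (l : A) → pathWeight (λ _ _ → k) x ys l ≡ k + length ys * k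
pathWeight-const k x []       l = sym (ℕ.+-identityʳ k)
pathWeight-const k x (y ∷ ys) l = cong (k +_) (pathWeight-const k y ys l)

cycleWeight-const : ∀ k (xs : List A) → cycleWeight (λ _ _ → k) xs ≡ length xs * k
cycleWeight-const k []       = refl
cycleWeight-const k (x ∷ xs) = pathWeight-const k x xs x

pathWeight-map : ∀ (c : B → B → ℕ) (f : A → B) x ys l →
  pathWeight c (f x) (map f ys) (f l) ≡ pathWeight (λ u v → c (f u) (f v)) x ys l
pathWeight-map c f x []       l = refl
pathWeight-map c f x (y ∷ ys) l = cong (c (f x) (f y) +_) (pathWeight-map c f y ys l)

cycleWeight-map : ∀ (c : B → B → ℕ) (f : A → B) xs →
  cycleWeight c (map f xs) ≡ cycleWeight (λ u v → c (f u) (f v)) xs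
cycleWeight-map c f []       = refl
cycleWeight-map c f (x ∷ xs) = pathWeight-map c f x xs x

module Bounds (G : GTSP) where

  weight≡cycleWeight : ∀ T → weight G T ≡ cycleWeight (w G) T
  weight≡cycleWeight []       = refl
  weight≡cycleWeight (x ∷ xs) = path≡ x xs x
    where
    path≡ : ∀ x ys l → pathTo G x ys l ≡ pathWeight (w G) x ys l
    path≡ x []       l = refl
    path≡ x (y ∷ ys) l = cong (w G x y +_) (path≡ y ys l)

  tour-length : ∀ {T} → IsTour G T → length T ≡ m G
  tour-length {T} t = begin
    length T                     ≡⟨ length-map (cluster G) T ⟨
    length (map (cluster G) T)   ≡⟨ ↭-length t ⟩
    length (allFin (m G))        ≡⟨ length-tabulate (λ i → i) ⟩
    m G                          ∎
    where open ≡-Reasoning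

  weight-≤ : ∀ {k T} → (∀ x y → w G x y ≤ k) → IsTour G T → weight G T ≤ m G * k
  weight-≤ {k} {T} w≤k t = begin
    weight G T                   ≡⟨ weight≡cycleWeight T ⟩
    cycleWeight (w G) T          ≤⟨ cycleWeight-mono {P = λ _ → ⊤} (λ {x} {y} _ _ → w≤k x y)
                                      (All.universal (λ _ → tt) T) ⟩
    cycleWeight (λ _ _ → k) T    ≡⟨ cycleWeight-const k T ⟩
    length T * k                 ≡⟨ cong (_* k) (tour-length t) ⟩
    m G * k                      ∎
    where open ℕ.≤-Reasoning

  weight-≥ : ∀ {P : Fin (n G) → Set} {k T} → (∀ {x y} → P x → P y → k ≤ w G x y) →
    IsTour G T → All P T → m G * k ≤ weight G T
  weight-≥ {k = k} {T} k≤w t pT = begin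
    m G * k                      ≡⟨ cong (_* k) (tour-length t) ⟨
    length T * k                 ≡⟨ cycleWeight-const k T ⟨
    cycleWeight (λ _ _ → k) T    ≤⟨ cycleWeight-mono k≤w pT ⟩
    cycleWeight (w G) T          ≡⟨ weight≡cycleWeight T ⟨
    weight G T                   ∎
    where open ℕ.≤-Reasoning

  weight-≥-clusters : ∀ {c : Fin (m G) → Fin (m G) → ℕ} →
    (∀ x y → c (cluster G x) (cluster G y) ≤ w G x y) →
    ∀ T → cycleWeight c (map (cluster G) T) ≤ weight G T
  weight-≥-clusters {c} c≤w T = begin
    cycleWeight c (map (cluster G) T)                               ≡⟨ cycleWeight-map c (cluster G) T ⟩
    cycleWeight (λ x y → c (cluster G x) (cluster G y)) T           ≤⟨ cycleWeight-mono {P = λ _ → ⊤}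
                                                                         (λ {x} {y} _ _ → c≤w x y)
                                                                         (All.universal (λ _ → tt) T) ⟩
    cycleWeight (w G) T                                             ≡⟨ weight≡cycleWeight T ⟨
    weight G T                                                      ∎
    where open ℕ.≤-Reasoning

open Bounds

cheapEdge : ℕ → ℕ → Bool
cheapEdge 1 4 = true
cheapEdge 4 1 = true
cheapEdge _ _ = false

edgeCost : Fin 5 → Fin 5 → ℕ
edgeCost x y = if cheapEdge (toℕ x) (toℕ y) then 0 else 1

clusterOf : Fin 5 → Fin 4
clusterOf zero                          = # 0
clusterOf (suc zero)                    = # 1
clusterOf (suc (suc zero))              = # 2
clusterOf (suc (suc (suc zero)))        = # 3
clusterOf (suc (suc (suc (suc zero))))  = # 3

G : GTSP
G = record
  { n = 5 ; m = 4 ; w = edgeCost ; cluster = clusterOf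
  ; cluster-surj = toWitness {a? = Fin.all? λ j → Fin.any? λ v → clusterOf v Fin.≟ j} tt }

-- The cheapest edge between two clusters: only clusters 1 and 3 are joined
-- by an edge of cost 0.
clusterCost : Fin 4 → Fin 4 → ℕ
clusterCost i j = if cheapClusters (toℕ i) (toℕ j) then 0 else 1
  where
  cheapClusters : ℕ → ℕ → Bool
  cheapClusters 1 3 = true
  cheapClusters 3 1 = true
  cheapClusters _ _ = false

T : List (Fin 5)
T = # 0 ∷ # 1 ∷ # 2 ∷ # 3 ∷ []

shortcut : List (Fin 5)
shortcut = # 0 ∷ # 2 ∷ # 1 ∷ # 4 ∷ []

tour-T : IsTour G T
tour-T = ↭-refl

tour-shortcut : IsTour G shortcut
tour-shortcut = prep (# 0) (swap (# 2) (# 1) ↭-refl)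

edgeCost-sym : Symmetric G
edgeCost-sym = toWitness {a? = Fin.all? λ x → Fin.all? λ y → edgeCost x y ℕ.≟ edgeCost y x} tt

edgeCost-≤1 : ∀ x y → edgeCost x y ≤ 1
edgeCost-≤1 = toWitness {a? = Fin.all? λ x → Fin.all? λ y → edgeCost x y ≤? 1} tt

clusterCost-≤ : ∀ x y → clusterCost (clusterOf x) (clusterOf y) ≤ edgeCost x y
clusterCost-≤ = toWitness
  {a? = Fin.all? λ x → Fin.all? λ y → clusterCost (clusterOf x) (clusterOf y) ≤? edgeCost x y} tt

-- Among the vertices of T every edge costs 1: the cheap edge needs vertex 4.
edgeCost-on-T : ∀ {x y} → x ∈ T → y ∈ T → 1 ≤ edgeCost x y
edgeCost-on-T {x} {y} = toWitness
  {a? = Fin.all? λ x → Fin.all? λ y → (x ∈? T) →-dec (y ∈? T) →-dec (1 ≤? edgeCost x y)} tt x y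

-- Every rotation and reflection of the cluster order 0 1 2 3 costs 4, since
-- clusters 1 and 3 are never consecutive in it.
rotations-cost : ∀ as bs → map clusterOf T ≡ as ++ bs →
  4 ≤ cycleWeight clusterCost (bs ++ as) × 4 ≤ cycleWeight clusterCost (reverse (bs ++ as))
rotations-cost []                    _ refl = ℕ.≤-refl , ℕ.≤-refl
rotations-cost (_ ∷ [])              _ refl = ℕ.≤-refl , ℕ.≤-refl
rotations-cost (_ ∷ _ ∷ [])          _ refl = ℕ.≤-refl , ℕ.≤-refl
rotations-cost (_ ∷ _ ∷ _ ∷ [])      _ refl = ℕ.≤-refl , ℕ.≤-refl
rotations-cost (_ ∷ _ ∷ _ ∷ _ ∷ [])  _ refl = ℕ.≤-refl , ℕ.≤-refl

cluster-order-cost : ∀ {s} → SameCyclicOrder (map clusterOf T) s → 4 ≤ cycleWeight clusterCost s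
cluster-order-cost (as , bs , e , inj₁ refl) = proj₁ (rotations-cost as bs e)
cluster-order-cost (as , bs , e , inj₂ refl) = proj₂ (rotations-cost as bs e)

theorem3 : ∃[ G ] ∃[ T ]
    (Symmetric G × IsTour G T
      × (∀ T' → InNCO G T T' ⊎ InNTSP G T T' → weight G T ≤ weight G T')
      × (∀ T' → IsTour G T' → weight G T' ≤ weight G T)
      × ¬ (∀ T' → IsTour G T' → weight G T ≤ weight G T'))
theorem3 = G , T , edgeCost-sym , tour-T , locally-optimal , longest , not-shortest
  where
  -- N_CO: the cluster sequence of T' already costs 4 under clusterCost.
  -- N_TSP: T' only visits vertices of T, between which all edges cost 1.
  locally-optimal : ∀ T' → InNCO G T T' ⊎ InNTSP G T T' → weight G T ≤ weight G T'
  locally-optimal T' (inj₁ (_ , order)) =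
    ≤-trans (cluster-order-cost order) (weight-≥-clusters G clusterCost-≤ T')
  locally-optimal T' (inj₂ (t' , T'↭T)) =
    weight-≥ G edgeCost-on-T t' (All.tabulate (∈-resp-↭ T'↭T))

  -- All four edges of T cost the maximal edge cost 1.
  longest : ∀ T' → IsTour G T' → weight G T' ≤ weight G T
  longest T' t' = weight-≤ G edgeCost-≤1 t'

  -- The tour through the cheap edge costs 3 < 4.
  not-shortest : ¬ (∀ T' → IsTour G T' → weight G T ≤ weight G T')
  not-shortest optimal = ℕ.<-irrefl refl (optimal shortcut tour-shortcut)
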